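{- Let $(\mathcal{L},\mathcal{G})$ be an irreducible built lattice, and for $G\in\mathcal{G}\setminus\{\hat1\}$ let $\mathbb{OS}(\{G\}):\mathrm{OS}(\mathcal{L})\to\mathrm{OS}([G,\hat1])\otimes\mathrm{OS}([\hat0,G])$ be the algebra morphism with $e_H\mapsto1\otimes e_H$ if $H\le G$ and $e_H\mapsto e_{G\vee H}\otimes 1$ otherwise. Then: (1) for $G_1<G_2<\hat1$ in $\mathcal{G}$, $(\mathrm{Id}\otimes\mathbb{OS}(\{G_1\}))\circ\mathbb{OS}(\{G_2\})=(\mathbb{OS}(\{G_2\})\otimes\mathrm{Id})\circ\mathbb{OS}(\{G_1\})$ as maps to $\mathrm{OS}([G_2,\hat1])\otimes\mathrm{OS}([G_1,G_2])\otimes\mathrm{OS}([\hat0,G_1])$ (on the right, $\mathbb{OS}(\{G_2\})$ is taken in $([G_1,\hat1],\mathrm{Ind}(\mathcal{G}))$); (2) for incomparable $G_1,G_2\in\mathcal{G}\setminus\{\hat1\}$ with $\{G_1,G_2\}$ nested, $(\mathbb{OS}(\{G_1\vee G_2\})\otimes\mathrm{Id})\circ\mathbb{OS}(\{G_2\})=\sigma_{2,3}\circ(\mathbb{OS}(\{G_1\vee G_2\})\otimes\mathrm{Id})\circ\mathbb{OS}(\{G_1\})$, where $\sigma_{2,3}$ swaps the last two tensor factors and $\mathrm{OS}([G_2,G_1\vee G_2])$ is identified with $\mathrm{OS}([\hat0,G_1])$ via $X\mapsto X\vee G_2$ (and symmetrically); (3) for every poset isomorphism $f:\mathcal{L}\to\mathcal{L}'$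 with $f(\mathcal{G})=\mathcal{G}'$ and every $G\in\mathcal{G}\setminus\{\hat1\}$, writing $\psi_f$ for the algebra isomorphism $e_H\mapsto e_{f(H)}$ (and similarly for restrictions of $f$ to intervals), $\mathbb{OS}(\{f(G)\})\circ\psi_f=(\psi_{f|_{[G,\hat1]}}\otimes\psi_{f|_{[\hat0,G]}})\circ\mathbb{OS}(\{G\})$.
   Context: Geometric lattice: finite lattice with bottom $\hat0$, top $\hat1$, all maximal chains between comparable elements of equal length (rank $\rho$), submodular rank, every element a join of atoms. A building set of $\mathcal{L}$ is $\mathcal{G}\subset\mathcal{L}\setminus\{\hat0\}$ such that for every $X$, with $\mathrm{Fact}_{\mathcal{G}}(X)$ the maximal elements of $\mathcal{G}\cap[\hat0,X]$, the join map $\prod_{G\in\mathrm{Fact}_{\mathcal{G}}(X)}[\hat0,G]\to[\hat0,X]$ is a poset isomorphism; irreducible if $\hat1\in\mathcal{G}$. For $G_1<G_2$, $\mathrm{Ind}_{[G_1,G_2]}(\mathcal{G})=\big(\{G_1\vee F:F\in\mathcal{G}\}\cap[G_1,G_2]\big)\setminus\{G_1\}$. A subset $\mathcal{S}\subset\mathcal{G}$ is nested if no antichain $\mathcal{A}\subset\mathcal{S}$ with $|\mathcal{A}|\ge2$ has $\bigvee\mathcal{A}\in\mathcal{G}$. A circuit is a set $C$ of $n$ atoms with $\rho(\bigvee C)=n-1$ and $\rho(\bigvee C')=|C'|$ for proper subsets $C'$. $\mathrm{OS}(\mathcal{L})=\Lambda[e_H:H\text{ atom}]/\mathcal{I}$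 over $\mathbb{Z}$, degree-$1$ generators, $\mathcal{I}$ generated by $\delta(e_{H_1}\wedge\dots\wedge e_{H_n})$ for circuits, $\delta$ the degree $-1$ derivation with $\delta(e_H)=1$. The morphisms $\mathbb{OS}(\{G\})$ are well-defined algebra morphisms; tensor products carry Koszul signs. -}

module Defs where

open import Function using (_∘_)
open import Data.Bool using (Bool; true; false; T; not; if_then_else_) renaming (_∧_ to _&&_)
open import Data.Nat using (ℕ; suc; _+_) renaming (_≤_ to _≤ℕ_; _<_ to _<ℕ_)
open import Data.Integer using (ℤ; +_) renaming (_+_ to _+ℤ_; _*_ to _*ℤ_)
open import Data.List using (List; []; _∷_; foldr; length; map; filterᵇ)
open import Data.List.Membership.Propositional using (_∈_)
open import Data.List.Relation.Unary.All using (All)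
open import Data.List.Relation.Unary.Unique.Propositional using (Unique)
open import Data.List.Relation.Binary.Sublist.Propositional using (_⊆_)
open import Data.List.Relation.Binary.Pointwise using (Pointwise)
open import Data.Product using (Σ; ∃; _×_; _,_; proj₁)
open import Data.Sum using (_⊎_; inj₁; inj₂; [_,_])
open import Relation.Binary.PropositionalEquality using (_≡_; _≢_)
open import Relation.Binary using (Decidable; DecidableEquality)
open import Relation.Binary.Lattice using (IsBoundedLattice)
open import Relation.Nullary using (Dec; yes; no; ¬_)
open import Relation.Nullary.Decidable using (⌊_⌋; T?)
open import Function.Bundles using (_⇔_)

infixl 6 _⊕_
infixl 7 _⊛_
infix 8 ⊖_
infix 4 _⊢_≈_

data Tm (V : Set) : Set where
  gen : V → Tm V
  con : ℤ → Tm V              -- integer scalars (con (+ 1) is the unit)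
  _⊕_ : Tm V → Tm V → Tm V
  _⊛_ : Tm V → Tm V → Tm V
  ⊖_  : Tm V → Tm V

-- substitution = the unique algebra morphism with given images of generators
_⟪_⟫ : ∀ {V W : Set} → Tm V → (V → Tm W) → Tm W
gen v ⟪ σ ⟫ = σ v
con z ⟪ σ ⟫ = con z
(s ⊕ t) ⟪ σ ⟫ = (s ⟪ σ ⟫) ⊕ (t ⟪ σ ⟫)
(s ⊛ t) ⟪ σ ⟫ = (s ⟪ σ ⟫) ⊛ (t ⟪ σ ⟫)
(⊖ s) ⟪ σ ⟫ = ⊖ (s ⟪ σ ⟫)

rename : ∀ {V W : Set} → (V → W) → Tm V → Tm W
rename f t = t ⟪ gen ∘ f ⟫

-- The congruence on Tm V defining the quotient
--   Λ_ℤ[ gen v : v ∈ V ] / ⟨ R ⟩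
-- i.e. the exterior algebra over ℤ on the degree-1 generators V
-- (e_v e_v = 0, e_v e_w = - e_w e_v) modulo the two-sided ideal
-- generated by the elements r with R r.
data _⊢_≈_ {V : Set} (R : Tm V → Set) : Tm V → Tm V → Set where
  ≈-refl  : ∀ {s} → R ⊢ s ≈ s
  ≈-sym   : ∀ {s t} → R ⊢ s ≈ t → R ⊢ t ≈ s
  ≈-trans : ∀ {s t u} → R ⊢ s ≈ t → R ⊢ t ≈ u → R ⊢ s ≈ u
  ⊕-cong  : ∀ {s s' t t'} → R ⊢ s ≈ s' → R ⊢ t ≈ t' → R ⊢ s ⊕ t ≈ s' ⊕ t'
  ⊛-cong  : ∀ {s s' t t'} → R ⊢ s ≈ s' → R ⊢ t ≈ t' → R ⊢ s ⊛ t ≈ s' ⊛ t'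
  ⊖-cong  : ∀ {s s'} → R ⊢ s ≈ s' → R ⊢ ⊖ s ≈ ⊖ s'
  ⊕-assoc : ∀ {s t u} → R ⊢ (s ⊕ t) ⊕ u ≈ s ⊕ (t ⊕ u)
  ⊕-comm  : ∀ {s t} → R ⊢ s ⊕ t ≈ t ⊕ s
  ⊕-identityˡ : ∀ {s} → R ⊢ con (+ 0) ⊕ s ≈ s
  ⊖-inverseˡ  : ∀ {s} → R ⊢ (⊖ s) ⊕ s ≈ con (+ 0)
  ⊛-assoc : ∀ {s t u} → R ⊢ (s ⊛ t) ⊛ u ≈ s ⊛ (t ⊛ u)
  ⊛-identityˡ : ∀ {s} → R ⊢ con (+ 1) ⊛ s ≈ s
  ⊛-identityʳ : ∀ {s} → R ⊢ s ⊛ con (+ 1) ≈ s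
  distribˡ : ∀ {s t u} → R ⊢ s ⊛ (t ⊕ u) ≈ (s ⊛ t) ⊕ (s ⊛ u)
  distribʳ : ∀ {s t u} → R ⊢ (t ⊕ u) ⊛ s ≈ (t ⊛ s) ⊕ (u ⊛ s)
  con-+ : ∀ {a b} → R ⊢ con (a +ℤ b) ≈ con a ⊕ con b
  con-* : ∀ {a b} → R ⊢ con (a *ℤ b) ≈ con a ⊛ con b
  gen-sq   : ∀ {v} → R ⊢ gen v ⊛ gen v ≈ con (+ 0)
  gen-anti : ∀ {v w} → R ⊢ (gen v ⊛ gen w) ⊕ (gen w ⊛ gen v) ≈ con (+ 0)
  rel : ∀ {r} → R r → R ⊢ r ≈ con (+ 0)

-- A graded-commutative algebra presented as Λ[Gen]/⟨Rel⟩.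
record Pres : Set₁ where
  field
    Gen : Set
    Rel : Tm Gen → Set
open Pres public

-- Tensor product with Koszul signs: for presentations with degree-1
-- generators, Λ[V]/I ⊗ Λ[W]/J = Λ[V ⊎ W]/(I + J)
-- (e_v ⊗ 1 and 1 ⊗ e_w anticommute).
_⊗ᴾ_ : Pres → Pres → Pres
P ⊗ᴾ Q = record
  { Gen = Gen P ⊎ Gen Q
  ; Rel = λ t → (∃ λ r → Rel P r × t ≡ rename inj₁ r)
              ⊎ (∃ λ r → Rel Q r × t ≡ rename inj₂ r) }

-- algebra morphisms Λ[Gen P]/… → Λ[Gen Q]/…, given by the images of the generators
record Hom (P Q : Pres) : Set where
  constructor hom
  field app : Gen P → Tm (Gen Q)
open Hom public

idH : ∀ {P} → Hom P P
idH = hom gen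

_∘H_ : ∀ {P Q S} → Hom Q S → Hom P Q → Hom P S
g ∘H f = hom (λ v → app f v ⟪ app g ⟫)

_⊗H_ : ∀ {P P' Q Q'} → Hom P Q → Hom P' Q' → Hom (P ⊗ᴾ P') (Q ⊗ᴾ Q')
f ⊗H g = hom [ (λ v → rename inj₁ (app f v)) , (λ v → rename inj₂ (app g v)) ]

assocH : ∀ {A B C} → Hom ((A ⊗ᴾ B) ⊗ᴾ C) (A ⊗ᴾ (B ⊗ᴾ C))
assocH = hom λ where
  (inj₁ (inj₁ a)) → gen (inj₁ a)
  (inj₁ (inj₂ b)) → gen (inj₂ (inj₁ b))
  (inj₂ c) → gen (inj₂ (inj₂ c))

σ₂₃ : ∀ {A B C} → Hom ((A ⊗ᴾ B) ⊗ᴾ C) ((A ⊗ᴾ C) ⊗ᴾ B)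
σ₂₃ = hom λ where
  (inj₁ (inj₁ a)) → gen (inj₁ (inj₁ a))
  (inj₁ (inj₂ b)) → gen (inj₂ b)
  (inj₂ c) → gen (inj₁ (inj₂ c))

-- equality of the induced maps (checked on all of Λ[Gen P], hence on the quotient)
HomEq : {P Q : Pres} → Hom P Q → Hom P Q → Set
HomEq {P} {Q} f g = ∀ (x : Tm (Gen P)) → Rel Q ⊢ (x ⟪ app f ⟫) ≈ (x ⟪ app g ⟫)

infixr 9 _∘H_
infixr 10 _⊗H_

-- product of generators and the derivation δ (δ e_v = 1, degree -1)
prodT : ∀ {V : Set} → List V → Tm V
prodT [] = con (+ 1)
prodT (v ∷ vs) = gen v ⊛ prodT vs

δ : ∀ {V : Set} → List V → Tm V
δ [] = con (+ 0)
δ (v ∷ vs) = prodT vs ⊕ (⊖ (gen v ⊛ δ vs))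

all : ∀ {A : Set} → (A → Bool) → List A → Bool
all p = foldr (λ x b → p x && b) true

record FinLattice : Set₁ where
  field
    Carrier  : Set
    _≟_      : DecidableEquality Carrier
    elements : List Carrier
    elements-complete : ∀ x → x ∈ elements
    elements-unique   : Unique elements
    _≤_  : Carrier → Carrier → Set
    _≤?_ : Decidable _≤_
    _∨_ _∧_ : Carrier → Carrier → Carrier
    ⊤ ⊥ : Carrier
    isBoundedLattice : IsBoundedLattice _≡_ _≤_ _∨_ _∧_ ⊤ ⊥

  _<_ : Carrier → Carrier → Set
  x < y = x ≤ y × x ≢ y

  _⋖_ : Carrier → Carrier → Set
  x ⋖ y = x < y × (∀ z → x ≤ z → z ≤ y → z ≡ x ⊎ z ≡ y)

  ⋁ : List Carrier → Carrier
  ⋁ = foldr _∨_ ⊥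

  _≤ᵇ_ : Carrier → Carrier → Bool
  x ≤ᵇ y = ⌊ x ≤? y ⌋

  _<ᵇ_ : Carrier → Carrier → Bool
  x <ᵇ y = (x ≤ᵇ y) && not ⌊ x ≟ y ⌋

  coverᵇ : Carrier → Carrier → Bool
  coverᵇ a x = (a <ᵇ x) && all (λ z → not ((a <ᵇ z) && (z <ᵇ x))) elements

  atomᵇ : Carrier → Carrier → Carrier → Bool
  atomᵇ a b x = coverᵇ a x && (x ≤ᵇ b)

record IsGeometric (L : FinLattice) : Set where
  open FinLattice L
  field
    ρ   : Carrier → ℕ
    ρ-⊥ : ρ ⊥ ≡ 0
    ρ-⋖ : ∀ {x y} → x ⋖ y → ρ y ≡ suc (ρ x)
    ρ-submodular : ∀ x y → ρ (x ∨ y) + ρ (x ∧ y) ≤ℕ ρ x + ρ y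
    atomistic : ∀ x → ∃ λ (As : List Carrier) → All (⊥ ⋖_) As × ⋁ As ≡ x

record GeometricLattice : Set₁ where
  field
    lat : FinLattice
    geo : IsGeometric lat
  open FinLattice lat public
  open IsGeometric geo public

module OverLattice (L : GeometricLattice) where
  open GeometricLattice L

  Atom : Carrier → Carrier → Set
  Atom a b = Σ Carrier (λ x → T (atomᵇ a b x))

  genOr0 : (a b x : Carrier) → Tm (Atom a b)
  genOr0 a b x with T? (atomᵇ a b x)
  ... | yes p = gen (x , p)
  ... | no _  = con (+ 0)

  -- circuits of the interval [a , b] (rank in [a,b] is ρ - ρ a, joins are a ∨ …)
  IsCircuit : (a b : Carrier) → List (Atom a b) → Set
  IsCircuit a b C =
    Unique (map proj₁ C)
    × (ρ (a ∨ ⋁ (map proj₁ C)) + 1 ≡ ρ a + length C)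
    × (∀ (C' : List Carrier) → C' ⊆ map proj₁ C → length C' <ℕ length C
         → ρ (a ∨ ⋁ C') ≡ ρ a + length C')

  OS : Carrier → Carrier → Pres
  OS a b = record
    { Gen = Atom a b
    ; Rel = λ t → ∃ λ C → IsCircuit a b C × t ≡ δ C }

  OSmap : (a G b : Carrier) → Hom (OS a b) (OS G b ⊗ᴾ OS a G)
  OSmap a G b = hom λ where
    (H , _) → if H ≤ᵇ G then rename inj₂ (genOr0 a G H)
                        else rename inj₁ (genOr0 G b (G ∨ H))

  -- the map OS([a,b]) → OS([c,d]), e_H ↦ e_{H ∨ c}
  -- (used for the identification OS([G₂ , G₁ ∨ G₂]) ≅ OS([0̂ , G₁]))
  joinMap : (a b c d : Carrier) → Hom (OS a b) (OS c d)
  joinMap a b c d = hom λ where (H , _) → genOr0 c d (H ∨ c)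

  Fact : (Carrier → Bool) → Carrier → List Carrier
  Fact 𝒢 X = filterᵇ
    (λ G → 𝒢 G && (G ≤ᵇ X)
             && all (λ G' → not (𝒢 G' && (G' ≤ᵇ X) && (G <ᵇ G'))) elements)
    elements

  IsBuildingSet : (Carrier → Bool) → Set
  IsBuildingSet 𝒢 =
    (𝒢 ⊥ ≡ false) ×
    (∀ X →
      -- the join map ∏_{G ∈ Fact X} [0̂ , G] → [0̂ , X] is surjective …
      (∀ Y → Y ≤ X → ∃ λ ys → Pointwise _≤_ ys (Fact 𝒢 X) × ⋁ ys ≡ Y)
      -- … and an order embedding
      × (∀ ys zs → Pointwise _≤_ ys (Fact 𝒢 X) → Pointwise _≤_ zs (Fact 𝒢 X)
           → (⋁ ys ≤ ⋁ zs ⇔ Pointwise _≤_ ys zs)))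

  IsNested : (Carrier → Bool) → List Carrier → Set
  IsNested 𝒢 S =
    ∀ (A : List Carrier) → (∀ {x} → x ∈ A → x ∈ S) → Unique A → 2 ≤ℕ length A
      → (∀ {x y} → x ∈ A → y ∈ A → x ≤ y → x ≡ y)
      → 𝒢 (⋁ A) ≡ false

open OverLattice public

ψ : (L L' : GeometricLattice)
    → (GeometricLattice.Carrier L → GeometricLattice.Carrier L')
    → (a b : GeometricLattice.Carrier L) (a' b' : GeometricLattice.Carrier L')
    → Hom (OS L a b) (OS L' a' b')
ψ L L' f a b a' b' = hom λ where (H , _) → genOr0 L' a' b' (f H)

IsPosetIso : (L L' : GeometricLattice)
    → (GeometricLattice.Carrier L → GeometricLattice.Carrier L') → Set
IsPosetIso L L' f =
  (∀ y → ∃ λ x → f x ≡ y)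
  × (∀ x y → GeometricLattice._≤_ L x y ⇔ GeometricLattice._≤_ L' (f x) (f y))

-- All maps involved are algebra morphisms given by the images of the generators e_H (H an
-- atom), so each identity is checked generator by generator: both sides send e_H to one
-- generator e_X of a single tensor factor, or to 0, and one compares by cases on which of the
-- Gᵢ lie above H.  The lattice input is semimodularity: for an atom H ≰ G the rank bound
-- ρ(G ∨ H) ≤ ρ(G) + 1 makes G ∨ H cover G, so e_{G ∨ H} is a generator of OS([G, 1̂]).  For (2) one
-- needs that an atom below G₁ ∨ G₂ lies below G₁ or G₂: G₁ and G₂ lie in different factors of
-- G₁ ∨ G₂ (otherwise G₁ ∨ G₂ ∈ 𝒢, against nestedness), and the atom, being in 𝒢, lies in a single
-- factor, so the product decomposition of [0̂, G₁ ∨ G₂] puts it below one of them.  For (3), a poset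
-- isomorphism preserves joins and covers, hence atoms of intervals.

module Submission where

open import Defs
open import Data.Bool using (Bool; true; false; T; not; if_then_else_) renaming (_∧_ to _&&_)
import Data.Bool as Bool
open import Data.Bool.Properties using (T-∧; T-≡; T-irrelevant)
open import Data.Integer using () renaming (+_ to +ℤ_)
open import Data.Empty using (⊥-elim)
open import Data.List using (List; []; _∷_; length; filter; map)
open import Data.List.Membership.Propositional using (_∈_; lose)
open import Data.List.Membership.Propositional.Properties using (∈-filter⁺; ∈-filter⁻)
open import Data.List.Relation.Binary.Pointwise using (Pointwise; []; _∷_)
open import Data.List.Relation.Unary.AllPairs using ([]; _∷_)
open import Data.List.Relation.Unary.All as All using (All; []; _∷_)
open import Data.List.Relation.Unary.Any using (here; there; any?; satisfied)
open import Data.Nat using (ℕ; suc; s≤s; z≤n; _+_) renaming (_≤_ to _≤ℕ_; _<_ to _<ℕ_)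
import Data.Nat.Properties as ℕ
import Data.Nat.Induction as ℕ
open import Data.Product using (_×_; _,_; proj₁; proj₂; ∃-syntax)
open import Data.Sum using (_⊎_; inj₁; inj₂; [_,_]′)
open import Function using (_∘_; flip)
open import Function.Bundles using (_⇔_; mk⇔; Equivalence)
open import Induction.WellFounded using (WellFounded; Acc; acc; module Subrelation)
open import Level using (0ℓ)
open import Relation.Binary using (Decidable; Transitive)
import Relation.Binary.Construct.On as On
open import Relation.Binary.Lattice using (BoundedLattice)
open import Relation.Binary.PropositionalEquality using (_≡_; _≢_; refl; sym; trans; cong; cong₂; subst; subst₂; module ≡-Reasoning)
open import Relation.Nullary using (¬_; yes; no; contradiction)
open import Relation.Nullary.Decidable using (⌊_⌋; T?; toSum; _×-dec_; ¬?; toWitness; fromWitness; toWitnessFalse; fromWitnessFalse)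
open import Relation.Unary using (Pred; _⊆_)
import Relation.Unary as U

T-all : ∀ {A : Set} (p : A → Bool) xs → T (all p xs) ⇔ All (T ∘ p) xs
T-all p [] = mk⇔ (λ _ → []) (λ _ → _)
T-all p (x ∷ xs) = mk⇔
  (λ t → let px , pxs = Equivalence.to T-∧ t in px ∷ Equivalence.to (T-all p xs) pxs)
  (λ where (px ∷ pxs) → Equivalence.from T-∧ (px , Equivalence.from (T-all p xs) pxs))

true≢false : true ≢ false
true≢false ()

T-not : ∀ {b} → T (not b) ⇔ (¬ T b)
T-not {true}  = mk⇔ (λ ()) (λ ¬t → ¬t _)
T-not {false} = mk⇔ (λ _ ()) (λ _ → _)

if-true : ∀ {A : Set} {b} {u v : A} → T b → (if b then u else v) ≡ u
if-true {b = true} _ = refl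

if-false : ∀ {A : Set} {b} {u v : A} → T (not b) → (if b then u else v) ≡ v
if-false {b = false} _ = refl

module _ {A : Set} {P Q : Pred A 0ℓ} (P? : U.Decidable P) (Q? : U.Decidable Q) (P⊆Q : P ⊆ Q) where

  length-filter-mono : ∀ xs → length (filter P? xs) ≤ℕ length (filter Q? xs)
  length-filter-mono [] = ℕ.≤-refl
  length-filter-mono (x ∷ xs) with P? x | Q? x
  ... | yes _  | yes _  = s≤s (length-filter-mono xs)
  ... | yes Px | no ¬Qx = contradiction (P⊆Q Px) ¬Qx
  ... | no _   | yes _  = ℕ.m≤n⇒m≤1+n (length-filter-mono xs)
  ... | no _   | no _   = length-filter-mono xs

  length-filter-< : ∀ {z xs} → z ∈ xs → Q z → ¬ P z → length (filter P? xs) <ℕ length (filter Q? xs)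
  length-filter-< {z} {_ ∷ xs} (here refl) Qz ¬Pz with P? z | Q? z
  ... | yes Pz | _      = contradiction Pz ¬Pz
  ... | no _   | yes _  = s≤s (length-filter-mono xs)
  ... | no _   | no ¬Qz = contradiction Qz ¬Qz
  length-filter-< {_} {x ∷ xs} (there z∈xs) Qz ¬Pz with P? x | Q? x
  ... | yes _  | yes _  = s≤s (length-filter-< z∈xs Qz ¬Pz)
  ... | yes Px | no ¬Qx = contradiction (P⊆Q Px) ¬Qx
  ... | no _   | yes _  = ℕ.m<n⇒m<1+n (length-filter-< z∈xs Qz ¬Pz)
  ... | no _   | no _   = length-filter-< z∈xs Qz ¬Pz

module _ {A : Set} {_≺_ : A → A → Set} (_≺?_ : Decidable _≺_)
         (≺-trans : Transitive _≺_) (≺-irrefl : ∀ {x} → ¬ x ≺ x)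
         (elements : List A) (complete : ∀ x → x ∈ elements) where

  private
    predecessors : A → ℕ
    predecessors y = length (filter (_≺? y) elements)

    predecessors-mono : ∀ {x y} → x ≺ y → predecessors x <ℕ predecessors y
    predecessors-mono {x} {y} x≺y =
      length-filter-< (_≺? x) (_≺? y) (λ z≺x → ≺-trans z≺x x≺y) (complete x) x≺y ≺-irrefl

  finite-wellFounded : WellFounded _≺_
  finite-wellFounded =
    Subrelation.wellFounded predecessors-mono (On.wellFounded predecessors ℕ.<-wellFounded)

module _ {A : Set} {R : A → A → Set} where

  Pointwise-map-self : (φ : A → A) → (∀ x → R (φ x) x) → ∀ xs → Pointwise R (map φ xs) xs
  Pointwise-map-self φ φ≤ []       = []
  Pointwise-map-self φ φ≤ (x ∷ xs) = φ≤ x ∷ Pointwise-map-self φ φ≤ xs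

  Pointwise-map-diagonal : (φ ψ : A → A) → ∀ {xs} → Pointwise R (map φ xs) (map ψ xs) →
                           ∀ {x} → x ∈ xs → R (φ x) (ψ x)
  Pointwise-map-diagonal φ ψ {_ ∷ _} (r ∷ _)  (here refl) = r
  Pointwise-map-diagonal φ ψ {_ ∷ _} (_ ∷ rs) (there x∈) = Pointwise-map-diagonal φ ψ rs x∈

module FinLatticeProperties (L : FinLattice) where
  open FinLattice L

  boundedLattice : BoundedLattice 0ℓ 0ℓ 0ℓ
  boundedLattice = record
    { Carrier = Carrier ; _≈_ = _≡_ ; _≤_ = _≤_ ; _∨_ = _∨_ ; _∧_ = _∧_
    ; ⊤ = ⊤ ; ⊥ = ⊥ ; isBoundedLattice = isBoundedLattice }

  open BoundedLattice boundedLattice public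
    using (x≤x∨y; y≤x∨y; ∨-least; minimum; maximum)
    renaming (refl to ≤-refl; reflexive to ≤-reflexive; trans to ≤-trans; antisym to ≤-antisym)
  open import Relation.Binary.Lattice.Properties.JoinSemilattice
    (BoundedLattice.joinSemilattice boundedLattice) public
    using (∨-comm; ∨-assoc; x≤y⇒x∨y≈y)
  open import Relation.Binary.Lattice.Properties.BoundedJoinSemilattice
    (BoundedLattice.boundedJoinSemilattice boundedLattice) public
    using (identityˡ; identityʳ)

  ∨-absorbs : ∀ {a J} H → a ≤ J → J ∨ (a ∨ H) ≡ J ∨ H
  ∨-absorbs {a} {J} H a≤J = begin
    J ∨ (a ∨ H) ≡⟨ ∨-assoc J a H ⟨
    (J ∨ a) ∨ H ≡⟨ cong (_∨ H) (trans (∨-comm J a) (x≤y⇒x∨y≈y a≤J)) ⟩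
    J ∨ H ∎
    where open ≡-Reasoning

  ⋁-map-least : (φ : Carrier → Carrier) → ∀ xs {b} → (∀ {x} → x ∈ xs → φ x ≤ b) → ⋁ (map φ xs) ≤ b
  ⋁-map-least φ []       φ≤b = minimum _
  ⋁-map-least φ (x ∷ xs) φ≤b = ∨-least (φ≤b (here refl)) (⋁-map-least φ xs (φ≤b ∘ there))

  ≤-⋁-map : (φ : Carrier → Carrier) → ∀ {x xs} → x ∈ xs → φ x ≤ ⋁ (map φ xs)
  ≤-⋁-map φ (here refl) = x≤x∨y _ _
  ≤-⋁-map φ {xs = y ∷ _} (there x∈) = ≤-trans (≤-⋁-map φ x∈) (y≤x∨y (φ y) _)

  <-irrefl : ∀ {x} → ¬ x < x
  <-irrefl (_ , x≢x) = x≢x refl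

  <-trans : Transitive _<_
  <-trans (x≤y , x≢y) (y≤z , _) = ≤-trans x≤y y≤z , λ { refl → x≢y (≤-antisym x≤y y≤z) }

  _<?_ : Decidable _<_
  x <? y = x ≤? y ×-dec ¬? (x ≟ y)

  <-wellFounded : WellFounded _<_
  <-wellFounded = finite-wellFounded _<?_ <-trans <-irrefl elements elements-complete

  >-wellFounded : WellFounded (flip _<_)
  >-wellFounded = finite-wellFounded (flip _<?_) (flip <-trans) <-irrefl elements elements-complete

  T-≤ᵇ : ∀ {x y} → T (x ≤ᵇ y) ⇔ x ≤ y
  T-≤ᵇ {x} {y} = mk⇔ (toWitness {a? = x ≤? y}) (fromWitness {a? = x ≤? y})

  T-<ᵇ : ∀ {x y} → T (x <ᵇ y) ⇔ x < y
  T-<ᵇ {x} {y} = mk⇔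
    (λ t → let x≤y , x≢y = Equivalence.to T-∧ t
           in Equivalence.to T-≤ᵇ x≤y , toWitnessFalse {a? = x ≟ y} x≢y)
    (λ (x≤y , x≢y) → Equivalence.from T-∧
      (Equivalence.from T-≤ᵇ x≤y , fromWitnessFalse {a? = x ≟ y} x≢y))

  T-coverᵇ : ∀ {a x} → T (coverᵇ a x) ⇔ a ⋖ x
  T-coverᵇ {a} {x} = mk⇔ to from
    where
    between : Carrier → Bool
    between z = (a <ᵇ z) && (z <ᵇ x)

    T-between : ∀ {z} → T (between z) ⇔ (a < z × z < x)
    T-between = mk⇔
      (λ t → let a<z , z<x = Equivalence.to T-∧ t
             in Equivalence.to T-<ᵇ a<z , Equivalence.to T-<ᵇ z<x)
      (λ (a<z , z<x) → Equivalence.from T-∧ (Equivalence.from T-<ᵇ a<z , Equivalence.from T-<ᵇ z<x))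

    to : T (coverᵇ a x) → a ⋖ x
    to t = Equivalence.to T-<ᵇ a<x , covers
      where
      a<x : T (a <ᵇ x)
      a<x = proj₁ (Equivalence.to T-∧ t)
      none-between : All (T ∘ (not ∘ between)) elements
      none-between = Equivalence.to (T-all _ elements) (proj₂ (Equivalence.to T-∧ t))
      covers : ∀ z → a ≤ z → z ≤ x → z ≡ a ⊎ z ≡ x
      covers z a≤z z≤x with z ≟ a | z ≟ x
      ... | yes z≡a | _       = inj₁ z≡a
      ... | no _    | yes z≡x = inj₂ z≡x
      ... | no z≢a  | no z≢x  =
        contradiction (Equivalence.from T-between ((a≤z , z≢a ∘ sym) , (z≤x , z≢x)))
                      (Equivalence.to T-not (All.lookup none-between (elements-complete z)))

    from : a ⋖ x → T (coverᵇ a x)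
    from (a<x , covers) = Equivalence.from T-∧ (Equivalence.from T-<ᵇ a<x ,
      Equivalence.from (T-all _ elements) (All.tabulate λ {z} _ →
        Equivalence.from T-not λ t → not-between z (Equivalence.to T-between t)))
      where
      not-between : ∀ z → ¬ (a < z × z < x)
      not-between z ((a≤z , a≢z) , (z≤x , z≢x)) with covers z a≤z z≤x
      ... | inj₁ z≡a = a≢z (sym z≡a)
      ... | inj₂ z≡x = z≢x z≡x

  T-atomᵇ : ∀ {a b x} → T (atomᵇ a b x) ⇔ (a ⋖ x × x ≤ b)
  T-atomᵇ = mk⇔
    (λ t → let c , l = Equivalence.to T-∧ t in Equivalence.to T-coverᵇ c , Equivalence.to T-≤ᵇ l)
    (λ (a⋖x , x≤b) → Equivalence.from T-∧ (Equivalence.from T-coverᵇ a⋖x , Equivalence.from T-≤ᵇ x≤b))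

  maximal-above : ∀ {P : Pred Carrier 0ℓ} → U.Decidable P → ∀ {x} → P x →
                  ∃[ m ] x ≤ m × P m × (∀ {z} → P z → ¬ m < z)
  maximal-above {P} P? {x} Px = climb (>-wellFounded x) ≤-refl Px
    where
    climb : ∀ {y} → Acc (flip _<_) y → x ≤ y → P y →
            ∃[ m ] x ≤ m × P m × (∀ {z} → P z → ¬ m < z)
    climb {y} (acc higher) x≤y Py with any? (λ z → P? z ×-dec y <? z) elements
    ... | yes ∃z = let z , Pz , y<z = satisfied ∃z
                   in climb (higher y<z) (≤-trans x≤y (proj₁ y<z)) Pz
    ... | no ∄z  = y , x≤y , Py , λ {z} Pz y<z → ∄z (lose (elements-complete z) (Pz , y<z))

  coatom-above : ∀ {x y} → x < y → ∃[ w ] x ≤ w × w ⋖ y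
  coatom-above {x} {y} x<y with maximal-above (λ z → x ≤? z ×-dec z <? y) (≤-refl , x<y)
  ... | w , _ , (x≤w , w<y) , maximal = w , x≤w , w<y , covers
    where
    covers : ∀ z → w ≤ z → z ≤ y → z ≡ w ⊎ z ≡ y
    covers z w≤z z≤y with z ≟ w | z ≟ y
    ... | yes z≡w | _       = inj₁ z≡w
    ... | no _    | yes z≡y = inj₂ z≡y
    ... | no z≢w  | no z≢y  = ⊥-elim (maximal (≤-trans x≤w w≤z , z≤y , z≢y) (w≤z , z≢w ∘ sym))

⟪⟫-cong : ∀ {U V : Set} (t : Tm U) {σ τ : U → Tm V} → (∀ v → σ v ≡ τ v) → t ⟪ σ ⟫ ≡ t ⟪ τ ⟫
⟪⟫-cong (gen v) σ≗τ = σ≗τ v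
⟪⟫-cong (con z) σ≗τ = refl
⟪⟫-cong (s ⊕ t) σ≗τ = cong₂ _⊕_ (⟪⟫-cong s σ≗τ) (⟪⟫-cong t σ≗τ)
⟪⟫-cong (s ⊛ t) σ≗τ = cong₂ _⊛_ (⟪⟫-cong s σ≗τ) (⟪⟫-cong t σ≗τ)
⟪⟫-cong (⊖ s)   σ≗τ = cong ⊖_ (⟪⟫-cong s σ≗τ)

pointwise⇒HomEq : ∀ {P Q : Pres} {f g : Hom P Q} → (∀ v → app f v ≡ app g v) → HomEq f g
pointwise⇒HomEq f≗g x = subst (_ ⊢ _ ≈_) (⟪⟫-cong x f≗g) ≈-refl

module GeometricLatticeProperties (L : GeometricLattice) where
  open GeometricLattice L
  open FinLatticeProperties lat public

  ρ-strictMono : ∀ {x y} → x < y → ρ x <ℕ ρ y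
  ρ-strictMono {y = y} = descend (<-wellFounded y)
    where
    descend : ∀ {x y} → Acc _<_ y → x < y → ρ x <ℕ ρ y
    descend {x} (acc lower) x<y with coatom-above x<y
    ... | w , x≤w , w⋖y@(w<y , _) = ℕ.≤-<-trans ρx≤ρw (ℕ.≤-reflexive (sym (ρ-⋖ w⋖y)))
      where
      ρx≤ρw : ρ x ≤ℕ ρ w
      ρx≤ρw with x ≟ w
      ... | yes refl = ℕ.≤-refl
      ... | no x≢w   = ℕ.<⇒≤ (descend (lower w<y) (x≤w , x≢w))

  ⋖-∨-atom : ∀ {G H} → ⊥ ⋖ H → ¬ H ≤ G → G ⋖ (G ∨ H)
  ⋖-∨-atom {G} {H} ⊥⋖H H≰G = (x≤x∨y G H , G≢G∨H) , covers
    where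
    G≢G∨H : G ≢ (G ∨ H)
    G≢G∨H G≡G∨H = H≰G (subst (H ≤_) (sym G≡G∨H) (y≤x∨y G H))

    ρ[G∨H]≤1+ρG : ρ (G ∨ H) ≤ℕ suc (ρ G)
    ρ[G∨H]≤1+ρG = begin
      ρ (G ∨ H)             ≤⟨ ℕ.m≤m+n _ _ ⟩
      ρ (G ∨ H) + ρ (G ∧ H) ≤⟨ ρ-submodular G H ⟩
      ρ G + ρ H             ≡⟨ cong (ρ G +_) (trans (ρ-⋖ ⊥⋖H) (cong suc ρ-⊥)) ⟩
      ρ G + 1               ≡⟨ ℕ.+-comm (ρ G) 1 ⟩
      suc (ρ G) ∎
      where open ℕ.≤-Reasoning

    covers : ∀ z → G ≤ z → z ≤ (G ∨ H) → z ≡ G ⊎ z ≡ (G ∨ H)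
    covers z G≤z z≤G∨H with z ≟ G | z ≟ (G ∨ H)
    ... | yes z≡G | _         = inj₁ z≡G
    ... | no _    | yes z≡G∨H = inj₂ z≡G∨H
    ... | no z≢G  | no z≢G∨H  = ⊥-elim (ℕ.<⇒≱ (ρ-strictMono (G≤z , z≢G ∘ sym))
        (ℕ.≤-pred (ℕ.≤-trans (ρ-strictMono (z≤G∨H , z≢G∨H)) ρ[G∨H]≤1+ρG)))

  atomᵇ-restrict : ∀ {a b c x} → T (atomᵇ a b x) → x ≤ c → T (atomᵇ a c x)
  atomᵇ-restrict p x≤c = Equivalence.from T-atomᵇ (proj₁ (Equivalence.to T-atomᵇ p) , x≤c)

  atomᵇ-∨ : ∀ {b c G H} → T (atomᵇ ⊥ b H) → ¬ H ≤ G → (G ∨ H) ≤ c → T (atomᵇ G c (G ∨ H))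
  atomᵇ-∨ p H≰G G∨H≤c =
    Equivalence.from T-atomᵇ (⋖-∨-atom (proj₁ (Equivalence.to T-atomᵇ p)) H≰G , G∨H≤c)

  genOr0-atom : ∀ {a b x} (p : T (atomᵇ a b x)) → genOr0 L a b x ≡ gen (x , p)
  genOr0-atom {a} {b} {x} p with T? (atomᵇ a b x)
  ... | yes q = cong (λ r → gen (x , r)) (T-irrelevant q p)
  ... | no ¬p = contradiction p ¬p

  genOr0-nonAtom : ∀ {a b x} → ¬ T (atomᵇ a b x) → genOr0 L a b x ≡ con (+ℤ 0)
  genOr0-nonAtom {a} {b} {x} ¬p with T? (atomᵇ a b x)
  ... | yes p = contradiction p ¬p
  ... | no _  = refl

  -- OSmap discards the proof p, so p cannot be inferred and is passed explicitly.
  OSmap-below : ∀ {a G b x} (p : T (atomᵇ a b x)) (q : T (atomᵇ a G x)) → x ≤ G →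
                app (OSmap L a G b) (x , p) ≡ gen (inj₂ (x , q))
  OSmap-below _ q x≤G =
    trans (if-true (Equivalence.from T-≤ᵇ x≤G)) (cong (rename inj₂) (genOr0-atom q))

  OSmap-above : ∀ {a G b x y} (p : T (atomᵇ a b x)) → G ∨ x ≡ y → (q : T (atomᵇ G b y)) →
                ¬ x ≤ G → app (OSmap L a G b) (x , p) ≡ gen (inj₁ (y , q))
  OSmap-above {G = G} {x = x} _ refl q x≰G =
    trans (if-false (fromWitnessFalse {a? = x ≤? G} x≰G)) (cong (rename inj₁) (genOr0-atom q))

  OSmap-coassoc : ∀ {G₁ G₂} → G₁ ≤ G₂ →
    HomEq {OS L ⊥ ⊤} {OS L G₂ ⊤ ⊗ᴾ (OS L G₁ G₂ ⊗ᴾ OS L ⊥ G₁)}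
      ((idH ⊗H OSmap L ⊥ G₁ G₂) ∘H OSmap L ⊥ G₂ ⊤)
      (assocH ∘H (OSmap L G₁ G₂ ⊤ ⊗H idH) ∘H OSmap L ⊥ G₁ ⊤)
  OSmap-coassoc {G₁} {G₂} G₁≤G₂ = pointwise⇒HomEq {f = lhs} {g = rhs} onAtom
    where
    open ≡-Reasoning
    lhs rhs : Hom (OS L ⊥ ⊤) (OS L G₂ ⊤ ⊗ᴾ (OS L G₁ G₂ ⊗ᴾ OS L ⊥ G₁))
    lhs = (idH ⊗H OSmap L ⊥ G₁ G₂) ∘H OSmap L ⊥ G₂ ⊤
    rhs = assocH ∘H (OSmap L G₁ G₂ ⊤ ⊗H idH) ∘H OSmap L ⊥ G₁ ⊤
    onAtom : ∀ v → app lhs v ≡ app rhs v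
    onAtom (H , p) with toSum (H ≤? G₁) | toSum (H ≤? G₂)
    ... | inj₁ H≤G₁ | _ = begin
      app (OSmap L ⊥ G₂ ⊤) (H , p) ⟪ _ ⟫
        ≡⟨ cong (_⟪ _ ⟫) (OSmap-below p q₂ (≤-trans H≤G₁ G₁≤G₂)) ⟩
      rename inj₂ (app (OSmap L ⊥ G₁ G₂) (H , q₂))
        ≡⟨ cong (rename inj₂) (OSmap-below q₂ q₁ H≤G₁) ⟩
      gen (inj₂ (inj₂ (H , q₁)))
        ≡⟨ cong (λ t → t ⟪ _ ⟫ ⟪ _ ⟫) (OSmap-below p q₁ H≤G₁) ⟨
      app (OSmap L ⊥ G₁ ⊤) (H , p) ⟪ _ ⟫ ⟪ _ ⟫ ∎
      where
      q₁ : T (atomᵇ ⊥ G₁ H)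
      q₁ = atomᵇ-restrict p H≤G₁
      q₂ : T (atomᵇ ⊥ G₂ H)
      q₂ = atomᵇ-restrict p (≤-trans H≤G₁ G₁≤G₂)
    ... | inj₂ H≰G₁ | inj₁ H≤G₂ = begin
      app (OSmap L ⊥ G₂ ⊤) (H , p) ⟪ _ ⟫
        ≡⟨ cong (_⟪ _ ⟫) (OSmap-below p q₂ H≤G₂) ⟩
      rename inj₂ (app (OSmap L ⊥ G₁ G₂) (H , q₂))
        ≡⟨ cong (rename inj₂) (OSmap-above q₂ refl r H≰G₁) ⟩
      gen (inj₂ (inj₁ (G₁ ∨ H , r)))
        ≡⟨ cong (λ t → rename inj₁ t ⟪ _ ⟫) (OSmap-below s r G₁∨H≤G₂) ⟨
      rename inj₁ (app (OSmap L G₁ G₂ ⊤) (G₁ ∨ H , s)) ⟪ _ ⟫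
        ≡⟨ cong (λ t → t ⟪ _ ⟫ ⟪ _ ⟫) (OSmap-above p refl s H≰G₁) ⟨
      app (OSmap L ⊥ G₁ ⊤) (H , p) ⟪ _ ⟫ ⟪ _ ⟫ ∎
      where
      G₁∨H≤G₂ : (G₁ ∨ H) ≤ G₂
      G₁∨H≤G₂ = ∨-least G₁≤G₂ H≤G₂
      q₂ : T (atomᵇ ⊥ G₂ H)
      q₂ = atomᵇ-restrict p H≤G₂
      r : T (atomᵇ G₁ G₂ (G₁ ∨ H))
      r = atomᵇ-∨ p H≰G₁ G₁∨H≤G₂
      s : T (atomᵇ G₁ ⊤ (G₁ ∨ H))
      s = atomᵇ-∨ p H≰G₁ (maximum _)
    ... | inj₂ H≰G₁ | inj₂ H≰G₂ = begin
      app (OSmap L ⊥ G₂ ⊤) (H , p) ⟪ _ ⟫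
        ≡⟨ cong (_⟪ _ ⟫) (OSmap-above p refl u H≰G₂) ⟩
      gen (inj₁ (G₂ ∨ H , u))
        ≡⟨ cong (λ t → rename inj₁ t ⟪ _ ⟫) (OSmap-above s (∨-absorbs H G₁≤G₂) u G₁∨H≰G₂) ⟨
      rename inj₁ (app (OSmap L G₁ G₂ ⊤) (G₁ ∨ H , s)) ⟪ _ ⟫
        ≡⟨ cong (λ t → t ⟪ _ ⟫ ⟪ _ ⟫) (OSmap-above p refl s H≰G₁) ⟨
      app (OSmap L ⊥ G₁ ⊤) (H , p) ⟪ _ ⟫ ⟪ _ ⟫ ∎
      where
      G₁∨H≰G₂ : ¬ (G₁ ∨ H) ≤ G₂
      G₁∨H≰G₂ G₁∨H≤G₂ = H≰G₂ (≤-trans (y≤x∨y G₁ H) G₁∨H≤G₂)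
      u : T (atomᵇ G₂ ⊤ (G₂ ∨ H))
      u = atomᵇ-∨ p H≰G₂ (maximum _)
      s : T (atomᵇ G₁ ⊤ (G₁ ∨ H))
      s = atomᵇ-∨ p H≰G₁ (maximum _)

  joinMap-atom : ∀ {a b c d x y} (p : T (atomᵇ a b x)) → x ∨ c ≡ y → (q : T (atomᵇ c d y)) →
                 app (joinMap L a b c d) (x , p) ≡ gen (y , q)
  joinMap-atom _ refl q = genOr0-atom q

  joinMap-nonAtom : ∀ {a b c d x} (p : T (atomᵇ a b x)) → ¬ T (atomᵇ c d (x ∨ c)) →
                    app (joinMap L a b c d) (x , p) ≡ con (+ℤ 0)
  joinMap-nonAtom _ = genOr0-nonAtom

  -- Both sides of the commutation identity for incomparable G₁, G₂ have this shape
  -- (with J = G₁ ∨ G₂), the right-hand one up to σ₂₃.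
  OSmap-through : (G G′ J : Carrier) → Hom (OS L ⊥ ⊤) ((OS L J ⊤ ⊗ᴾ OS L G J) ⊗ᴾ OS L G′ J)
  OSmap-through G G′ J = (idH ⊗H joinMap L ⊥ G G′ J) ∘H (OSmap L G J ⊤ ⊗H idH) ∘H OSmap L ⊥ G ⊤

  module _ {G G′ J H : Carrier} (p : T (atomᵇ ⊥ ⊤ H)) where
    open ≡-Reasoning

    OSmap-through-below-both : H ≤ G → H ≤ G′ → app (OSmap-through G G′ J) (H , p) ≡ con (+ℤ 0)
    OSmap-through-below-both H≤G H≤G′ = begin
      app (OSmap L ⊥ G ⊤) (H , p) ⟪ _ ⟫ ⟪ _ ⟫
        ≡⟨ cong (λ t → t ⟪ _ ⟫ ⟪ _ ⟫) (OSmap-below p r H≤G) ⟩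
      rename inj₂ (app (joinMap L ⊥ G G′ J) (H , r))
        ≡⟨ cong (rename inj₂) (joinMap-nonAtom r G′-not-atom) ⟩
      con (+ℤ 0) ∎
      where
      r : T (atomᵇ ⊥ G H)
      r = atomᵇ-restrict p H≤G
      G′-not-atom : ¬ T (atomᵇ G′ J (H ∨ G′))
      G′-not-atom t = <-irrefl (proj₁ (proj₁ (Equivalence.to T-atomᵇ
                        (subst (T ∘ atomᵇ G′ J) (x≤y⇒x∨y≈y H≤G′) t))))

    OSmap-through-below : (q : T (atomᵇ G′ J (G′ ∨ H))) → H ≤ G →
                          app (OSmap-through G G′ J) (H , p) ≡ gen (inj₂ (G′ ∨ H , q))
    OSmap-through-below q H≤G = begin
      app (OSmap L ⊥ G ⊤) (H , p) ⟪ _ ⟫ ⟪ _ ⟫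
        ≡⟨ cong (λ t → t ⟪ _ ⟫ ⟪ _ ⟫) (OSmap-below p r H≤G) ⟩
      rename inj₂ (app (joinMap L ⊥ G G′ J) (H , r))
        ≡⟨ cong (rename inj₂) (joinMap-atom r (∨-comm H G′) q) ⟩
      gen (inj₂ (G′ ∨ H , q)) ∎
      where
      r : T (atomᵇ ⊥ G H)
      r = atomᵇ-restrict p H≤G

    OSmap-through-middle : (q : T (atomᵇ G J (G ∨ H))) → ¬ H ≤ G →
                           app (OSmap-through G G′ J) (H , p) ≡ gen (inj₁ (inj₂ (G ∨ H , q)))
    OSmap-through-middle q H≰G = begin
      app (OSmap L ⊥ G ⊤) (H , p) ⟪ _ ⟫ ⟪ _ ⟫
        ≡⟨ cong (λ t → t ⟪ _ ⟫ ⟪ _ ⟫) (OSmap-above p refl s H≰G) ⟩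
      rename inj₁ (app (OSmap L G J ⊤) (G ∨ H , s)) ⟪ _ ⟫
        ≡⟨ cong (λ t → rename inj₁ t ⟪ _ ⟫) (OSmap-below s q G∨H≤J) ⟩
      gen (inj₁ (inj₂ (G ∨ H , q))) ∎
      where
      s : T (atomᵇ G ⊤ (G ∨ H))
      s = atomᵇ-∨ p H≰G (maximum _)
      G∨H≤J : (G ∨ H) ≤ J
      G∨H≤J = proj₂ (Equivalence.to T-atomᵇ q)

    OSmap-through-above : (q : T (atomᵇ J ⊤ (J ∨ H))) → G ≤ J → ¬ H ≤ J →
                          app (OSmap-through G G′ J) (H , p) ≡ gen (inj₁ (inj₁ (J ∨ H , q)))
    OSmap-through-above q G≤J H≰J = begin
      app (OSmap L ⊥ G ⊤) (H , p) ⟪ _ ⟫ ⟪ _ ⟫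
        ≡⟨ cong (λ t → t ⟪ _ ⟫ ⟪ _ ⟫) (OSmap-above p refl s H≰G) ⟩
      rename inj₁ (app (OSmap L G J ⊤) (G ∨ H , s)) ⟪ _ ⟫
        ≡⟨ cong (λ t → rename inj₁ t ⟪ _ ⟫) (OSmap-above s (∨-absorbs H G≤J) q G∨H≰J) ⟩
      gen (inj₁ (inj₁ (J ∨ H , q))) ∎
      where
      H≰G : ¬ H ≤ G
      H≰G H≤G = H≰J (≤-trans H≤G G≤J)
      G∨H≰J : ¬ (G ∨ H) ≤ J
      G∨H≰J G∨H≤J = H≰J (≤-trans (y≤x∨y G H) G∨H≤J)
      s : T (atomᵇ G ⊤ (G ∨ H))
      s = atomᵇ-∨ p H≰G (maximum _)

module PosetIsoProperties (L L′ : GeometricLattice)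
  (f : GeometricLattice.Carrier L → GeometricLattice.Carrier L′) (iso : IsPosetIso L L′ f) where

  open GeometricLattice L
  open GeometricLatticeProperties L
  private module L′ where
    open GeometricLattice L′ public
    open GeometricLatticeProperties L′ public

  f-mono : ∀ {x y} → x ≤ y → f x L′.≤ f y
  f-mono = Equivalence.to (proj₂ iso _ _)

  f-reflects : ∀ {x y} → f x L′.≤ f y → x ≤ y
  f-reflects = Equivalence.from (proj₂ iso _ _)

  f-injective : ∀ {x y} → f x ≡ f y → x ≡ y
  f-injective fx≡fy = ≤-antisym (f-reflects (L′.≤-reflexive fx≡fy)) (f-reflects (L′.≤-reflexive (sym fx≡fy)))

  f-⊥ : f ⊥ ≡ L′.⊥
  f-⊥ with proj₁ iso L′.⊥
  ... | x , fx≡⊥ = L′.≤-antisym (subst (f ⊥ L′.≤_) fx≡⊥ (f-mono (minimum x))) (L′.minimum (f ⊥))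

  f-⊤ : f ⊤ ≡ L′.⊤
  f-⊤ with proj₁ iso L′.⊤
  ... | x , fx≡⊤ = L′.≤-antisym (L′.maximum (f ⊤)) (subst (L′._≤ f ⊤) fx≡⊤ (f-mono (maximum x)))

  f-∨ : ∀ x y → f (x ∨ y) ≡ f x L′.∨ f y
  f-∨ x y with proj₁ iso (f x L′.∨ f y)
  ... | w , fw≡fx∨fy = L′.≤-antisym
    (subst (f (x ∨ y) L′.≤_) fw≡fx∨fy (f-mono (∨-least (below (L′.x≤x∨y _ _)) (below (L′.y≤x∨y _ _)))))
    (L′.∨-least (f-mono (x≤x∨y x y)) (f-mono (y≤x∨y x y)))
    where
    below : ∀ {z} → (f z L′.≤ (f x L′.∨ f y)) → z ≤ w
    below fz≤ = f-reflects (subst (_ L′.≤_) (sym fw≡fx∨fy) fz≤)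

  f-⋖ : ∀ {x y} → x ⋖ y → f x L′.⋖ f y
  f-⋖ ((x≤y , x≢y) , covers) = (f-mono x≤y , x≢y ∘ f-injective) , covers′
    where
    covers′ : ∀ z → f _ L′.≤ z → z L′.≤ f _ → z ≡ f _ ⊎ z ≡ f _
    covers′ z fx≤z z≤fy with proj₁ iso z
    ... | w , refl with covers w (f-reflects fx≤z) (f-reflects z≤fy)
    ...   | inj₁ w≡x = inj₁ (cong f w≡x)
    ...   | inj₂ w≡y = inj₂ (cong f w≡y)

  f-atomᵇ : ∀ {a b x} → T (atomᵇ a b x) → T (L′.atomᵇ (f a) (f b) (f x))
  f-atomᵇ p = let a⋖x , x≤b = Equivalence.to T-atomᵇ p
              in Equivalence.from L′.T-atomᵇ (f-⋖ a⋖x , f-mono x≤b)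

  OSmap-natural : ∀ G →
    HomEq {OS L ⊥ ⊤} {OS L′ (f G) L′.⊤ ⊗ᴾ OS L′ L′.⊥ (f G)}
      (OSmap L′ L′.⊥ (f G) L′.⊤ ∘H ψ L L′ f ⊥ ⊤ L′.⊥ L′.⊤)
      ((ψ L L′ f G ⊤ (f G) L′.⊤ ⊗H ψ L L′ f ⊥ G L′.⊥ (f G)) ∘H OSmap L ⊥ G ⊤)
  OSmap-natural G = pointwise⇒HomEq {f = lhs} {g = rhs} onAtom
    where
    open ≡-Reasoning
    lhs rhs : Hom (OS L ⊥ ⊤) (OS L′ (f G) L′.⊤ ⊗ᴾ OS L′ L′.⊥ (f G))
    lhs = OSmap L′ L′.⊥ (f G) L′.⊤ ∘H ψ L L′ f ⊥ ⊤ L′.⊥ L′.⊤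
    rhs = (ψ L L′ f G ⊤ (f G) L′.⊤ ⊗H ψ L L′ f ⊥ G L′.⊥ (f G)) ∘H OSmap L ⊥ G ⊤
    f-atom : ∀ {H} → T (atomᵇ ⊥ ⊤ H) → T (L′.atomᵇ L′.⊥ L′.⊤ (f H))
    f-atom p = subst₂ (λ a b → T (L′.atomᵇ a b _)) f-⊥ f-⊤ (f-atomᵇ p)
    onAtom : ∀ v → app lhs v ≡ app rhs v
    onAtom (H , p) with toSum (H ≤? G)
    ... | inj₁ H≤G = begin
      genOr0 L′ L′.⊥ L′.⊤ (f H) ⟪ _ ⟫
        ≡⟨ cong (_⟪ _ ⟫) (L′.genOr0-atom (f-atom p)) ⟩
      app (OSmap L′ L′.⊥ (f G) L′.⊤) (f H , f-atom p)
        ≡⟨ L′.OSmap-below (f-atom p) q′ (f-mono H≤G) ⟩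
      gen (inj₂ (f H , q′))
        ≡⟨ cong (rename inj₂) (L′.genOr0-atom q′) ⟨
      rename inj₂ (genOr0 L′ L′.⊥ (f G) (f H))
        ≡⟨ cong (_⟪ _ ⟫) (OSmap-below p q H≤G) ⟨
      app (OSmap L ⊥ G ⊤) (H , p) ⟪ _ ⟫ ∎
      where
      q : T (atomᵇ ⊥ G H)
      q = atomᵇ-restrict p H≤G
      q′ : T (L′.atomᵇ L′.⊥ (f G) (f H))
      q′ = subst (λ a → T (L′.atomᵇ a (f G) (f H))) f-⊥ (f-atomᵇ q)
    ... | inj₂ H≰G = begin
      genOr0 L′ L′.⊥ L′.⊤ (f H) ⟪ _ ⟫
        ≡⟨ cong (_⟪ _ ⟫) (L′.genOr0-atom (f-atom p)) ⟩
      app (OSmap L′ L′.⊥ (f G) L′.⊤) (f H , f-atom p)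
        ≡⟨ L′.OSmap-above (f-atom p) (sym (f-∨ G H)) r′ (H≰G ∘ f-reflects) ⟩
      gen (inj₁ (f (G ∨ H) , r′))
        ≡⟨ cong (rename inj₁) (L′.genOr0-atom r′) ⟨
      rename inj₁ (genOr0 L′ (f G) L′.⊤ (f (G ∨ H)))
        ≡⟨ cong (_⟪ _ ⟫) (OSmap-above p refl r H≰G) ⟨
      app (OSmap L ⊥ G ⊤) (H , p) ⟪ _ ⟫ ∎
      where
      r : T (atomᵇ G ⊤ (G ∨ H))
      r = atomᵇ-∨ p H≰G (maximum _)
      r′ : T (L′.atomᵇ (f G) L′.⊤ (f (G ∨ H)))
      r′ = subst (λ b → T (L′.atomᵇ (f G) b (f (G ∨ H)))) f-⊤ (f-atomᵇ r)

module BuildingSetProperties (L : GeometricLattice) (𝒢 : GeometricLattice.Carrier L → Bool)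
  (building : IsBuildingSet L 𝒢) where

  open GeometricLattice L
  open GeometricLatticeProperties L

  ∈Fact⁻ : ∀ {X F} → F ∈ Fact L 𝒢 X → 𝒢 F ≡ true × F ≤ X
  ∈Fact⁻ F∈ = let 𝒢F , rest = Equivalence.to T-∧ (proj₂ (∈-filter⁻ _ {xs = elements} F∈))
              in Equivalence.to T-≡ 𝒢F , Equivalence.to T-≤ᵇ (proj₁ (Equivalence.to T-∧ rest))

  ∈Fact⁺ : ∀ {X F} → 𝒢 F ≡ true → F ≤ X → (∀ {G} → 𝒢 G ≡ true × G ≤ X → ¬ F < G) →
           F ∈ Fact L 𝒢 X
  ∈Fact⁺ {X} {F} 𝒢F F≤X maximal = ∈-filter⁺ _ {xs = elements} (elements-complete F)
    (Equivalence.from T-∧ (Equivalence.from T-≡ 𝒢F , Equivalence.from T-∧ (Equivalence.from T-≤ᵇ F≤X ,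
      Equivalence.from (T-all _ elements) (All.tabulate λ _ → Equivalence.from T-not λ t →
        let 𝒢G , rest = Equivalence.to T-∧ t
            G≤X , F<G = Equivalence.to T-∧ rest
        in maximal (Equivalence.to T-≡ 𝒢G , Equivalence.to T-≤ᵇ G≤X) (Equivalence.to T-<ᵇ F<G)))))

  factor-above : ∀ {X G} → 𝒢 G ≡ true → G ≤ X → ∃[ F ] F ∈ Fact L 𝒢 X × G ≤ F
  factor-above {X} 𝒢G G≤X with maximal-above (λ z → 𝒢 z Bool.≟ true ×-dec z ≤? X) (𝒢G , G≤X)
  ... | F , G≤F , (𝒢F , F≤X) , maximal = F , ∈Fact⁺ 𝒢F F≤X maximal , G≤F

  Fact-nonempty : ∀ {X} → X ≢ ⊥ → ∃[ K ] K ∈ Fact L 𝒢 X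
  Fact-nonempty {X} X≢⊥ = let ys , ys≤Fact , ⋁ys≡X = proj₁ (proj₂ building X) X ≤-refl
                          in first ys≤Fact ⋁ys≡X
    where
    first : ∀ {ys fs} → Pointwise _≤_ ys fs → ⋁ ys ≡ X → ∃[ K ] K ∈ fs
    first []      ⊥≡X = ⊥-elim (X≢⊥ (sym ⊥≡X))
    first (_ ∷ _) _   = _ , here refl

  ⊥∉𝒢 : ∀ {X} → 𝒢 X ≡ true → X ≢ ⊥
  ⊥∉𝒢 𝒢X refl = true≢false (trans (sym 𝒢X) (proj₁ building))

  atom∈𝒢 : ∀ {H} → ⊥ ⋖ H → 𝒢 H ≡ true
  atom∈𝒢 {H} ((_ , ⊥≢H) , covers) with Fact-nonempty (⊥≢H ∘ sym)
  ... | K , K∈ with ∈Fact⁻ K∈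
  ...   | 𝒢K , K≤H with covers K (minimum K) K≤H
  ...     | inj₁ K≡⊥ = ⊥-elim (⊥∉𝒢 𝒢K K≡⊥)
  ...     | inj₂ refl = 𝒢K

  Fact-reflects-≤ : ∀ {X} (φ ψ : Carrier → Carrier) → (∀ K → φ K ≤ K) → (∀ K → ψ K ≤ K) →
                    ⋁ (map φ (Fact L 𝒢 X)) ≤ ⋁ (map ψ (Fact L 𝒢 X)) →
                    ∀ {F} → F ∈ Fact L 𝒢 X → φ F ≤ ψ F
  Fact-reflects-≤ {X} φ ψ φ≤ ψ≤ ⋁φ≤⋁ψ = Pointwise-map-diagonal φ ψ
    (Equivalence.to (proj₂ (proj₂ building X) _ _ (Pointwise-map-self φ φ≤ _) (Pointwise-map-self ψ ψ≤ _))
                    ⋁φ≤⋁ψ)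

  -- A tuple of the decomposition ∏_{F ∈ Fact X} [0̂, F] is a function on factors (mapped over Fact X);
  -- this one is Y at F and 0̂ elsewhere.
  onlyAt : Carrier → Carrier → Carrier → Carrier
  onlyAt F Y K = if ⌊ K ≟ F ⌋ then Y else ⊥

  onlyAt-here : ∀ F Y → onlyAt F Y F ≡ Y
  onlyAt-here F Y = if-true (fromWitness {a? = F ≟ F} refl)

  onlyAt-elsewhere : ∀ {F K} Y → K ≢ F → onlyAt F Y K ≡ ⊥
  onlyAt-elsewhere {F} {K} Y K≢F = if-false (fromWitnessFalse {a? = K ≟ F} K≢F)

  onlyAt-≤ : ∀ {F Y K B} → (K ≡ F → Y ≤ B) → onlyAt F Y K ≤ B
  onlyAt-≤ {F} {Y} {K} {B} Y≤B with toSum (K ≟ F)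
  ... | inj₁ refl = subst (_≤ B) (sym (onlyAt-here F Y)) (Y≤B refl)
  ... | inj₂ K≢F  = subst (_≤ B) (sym (onlyAt-elsewhere Y K≢F)) (minimum B)

  -- Z lies in a single factor F; comparing the tuples (Z at F) and (Y₁ at F₁, Y₂ at F₂)
  -- at F leaves only Y₁, Y₂ or 0̂ as an upper bound for Z.
  𝒢-below-join-of-factors : ∀ {X F₁ F₂ Y₁ Y₂ Z} → F₁ ∈ Fact L 𝒢 X → F₂ ∈ Fact L 𝒢 X → F₁ ≢ F₂ →
                            Y₁ ≤ F₁ → Y₂ ≤ F₂ → 𝒢 Z ≡ true → Z ≤ (Y₁ ∨ Y₂) → Z ≤ Y₁ ⊎ Z ≤ Y₂
  𝒢-below-join-of-factors {X} {F₁} {F₂} {Y₁} {Y₂} {Z} F₁∈ F₂∈ F₁≢F₂ Y₁≤F₁ Y₂≤F₂ 𝒢Z Z≤Y₁∨Y₂ =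
    component (factor-above 𝒢Z Z≤X)
    where
    Z≤X : Z ≤ X
    Z≤X = ≤-trans Z≤Y₁∨Y₂
      (∨-least (≤-trans Y₁≤F₁ (proj₂ (∈Fact⁻ F₁∈))) (≤-trans Y₂≤F₂ (proj₂ (∈Fact⁻ F₂∈))))

    pair : Carrier → Carrier
    pair K = onlyAt F₁ Y₁ K ∨ onlyAt F₂ Y₂ K

    Y₁∨Y₂≤⋁pair : (Y₁ ∨ Y₂) ≤ ⋁ (map pair (Fact L 𝒢 X))
    Y₁∨Y₂≤⋁pair = ∨-least
      (≤-trans (≤-reflexive (sym (onlyAt-here F₁ Y₁))) (≤-trans (x≤x∨y _ _) (≤-⋁-map pair F₁∈)))
      (≤-trans (≤-reflexive (sym (onlyAt-here F₂ Y₂))) (≤-trans (y≤x∨y _ _) (≤-⋁-map pair F₂∈)))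

    Z≤pair : ∀ {F} → F ∈ Fact L 𝒢 X → Z ≤ F → Z ≤ pair F
    Z≤pair {F} F∈ Z≤F = subst (_≤ pair F) (onlyAt-here F Z) (Fact-reflects-≤ (onlyAt F Z) pair
      (λ _ → onlyAt-≤ λ { refl → Z≤F })
      (λ _ → ∨-least (onlyAt-≤ λ { refl → Y₁≤F₁ }) (onlyAt-≤ λ { refl → Y₂≤F₂ }))
      (≤-trans (⋁-map-least (onlyAt F Z) (Fact L 𝒢 X) λ _ → onlyAt-≤ λ _ → ≤-refl) (≤-trans Z≤Y₁∨Y₂ Y₁∨Y₂≤⋁pair))
      F∈)

    component : (∃[ F ] F ∈ Fact L 𝒢 X × Z ≤ F) → Z ≤ Y₁ ⊎ Z ≤ Y₂
    component (F , F∈ , Z≤F) with toSum (F ≟ F₁) | toSum (F ≟ F₂)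
    ... | inj₁ refl | _ = inj₁ (subst (Z ≤_)
      (trans (cong₂ _∨_ (onlyAt-here F₁ Y₁) (onlyAt-elsewhere Y₂ F₁≢F₂)) (identityʳ Y₁)) (Z≤pair F∈ Z≤F))
    ... | inj₂ F≢F₁ | inj₁ refl = inj₂ (subst (Z ≤_)
      (trans (cong₂ _∨_ (onlyAt-elsewhere Y₁ F≢F₁) (onlyAt-here F₂ Y₂)) (identityˡ Y₂)) (Z≤pair F∈ Z≤F))
    ... | inj₂ F≢F₁ | inj₂ F≢F₂ = ⊥-elim (⊥∉𝒢 𝒢Z (≤-antisym (subst (Z ≤_)
      (trans (cong₂ _∨_ (onlyAt-elsewhere Y₁ F≢F₁) (onlyAt-elsewhere Y₂ F≢F₂)) (identityʳ ⊥)) (Z≤pair F∈ Z≤F))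
      (minimum Z)))

  nested-pair-join∉𝒢 : ∀ {G₁ G₂} → IsNested L 𝒢 (G₁ ∷ G₂ ∷ []) → ¬ G₁ ≤ G₂ → ¬ G₂ ≤ G₁ →
                       𝒢 (G₁ ∨ G₂) ≡ false
  nested-pair-join∉𝒢 {G₁} {G₂} nested G₁≰G₂ G₂≰G₁ =
    subst (λ J → 𝒢 (G₁ ∨ J) ≡ false) (identityʳ G₂)
      (nested (G₁ ∷ G₂ ∷ []) (λ x∈ → x∈) (((G₁≰G₂ ∘ ≤-reflexive) ∷ []) ∷ [] ∷ []) (s≤s (s≤s z≤n)) antichain)
    where
    antichain : ∀ {x y} → x ∈ G₁ ∷ G₂ ∷ [] → y ∈ G₁ ∷ G₂ ∷ [] → x ≤ y → x ≡ y
    antichain (here refl)         (here refl)         _     = refl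
    antichain (here refl)         (there (here refl)) G₁≤G₂ = ⊥-elim (G₁≰G₂ G₁≤G₂)
    antichain (there (here refl)) (here refl)         G₂≤G₁ = ⊥-elim (G₂≰G₁ G₂≤G₁)
    antichain (there (here refl)) (there (here refl)) _     = refl

  atom-below-nested-join : ∀ {G₁ G₂ H} → 𝒢 G₁ ≡ true → 𝒢 G₂ ≡ true → ¬ G₁ ≤ G₂ → ¬ G₂ ≤ G₁ →
                           IsNested L 𝒢 (G₁ ∷ G₂ ∷ []) → ⊥ ⋖ H → H ≤ (G₁ ∨ G₂) → H ≤ G₁ ⊎ H ≤ G₂
  atom-below-nested-join {G₁} {G₂} 𝒢G₁ 𝒢G₂ G₁≰G₂ G₂≰G₁ nested ⊥⋖H H≤J
    with factor-above 𝒢G₁ (x≤x∨y G₁ G₂) | factor-above 𝒢G₂ (y≤x∨y G₁ G₂)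
  ... | F₁ , F₁∈ , G₁≤F₁ | F₂ , F₂∈ , G₂≤F₂ =
    𝒢-below-join-of-factors F₁∈ F₂∈ F₁≢F₂ G₁≤F₁ G₂≤F₂ (atom∈𝒢 ⊥⋖H) H≤J
    where
    F₁≢F₂ : F₁ ≢ F₂
    F₁≢F₂ refl = true≢false (begin
      true        ≡⟨ proj₁ (∈Fact⁻ F₁∈) ⟨
      𝒢 F₁        ≡⟨ cong 𝒢 (≤-antisym (proj₂ (∈Fact⁻ F₁∈)) (∨-least G₁≤F₁ G₂≤F₂)) ⟩
      𝒢 (G₁ ∨ G₂) ≡⟨ nested-pair-join∉𝒢 nested G₁≰G₂ G₂≰G₁ ⟩
      false ∎)
      where open ≡-Reasoning

  OSmap-commute : ∀ {G₁ G₂} → 𝒢 G₁ ≡ true → 𝒢 G₂ ≡ true → ¬ G₁ ≤ G₂ → ¬ G₂ ≤ G₁ →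
    IsNested L 𝒢 (G₁ ∷ G₂ ∷ []) →
    HomEq {OS L ⊥ ⊤} {(OS L (G₁ ∨ G₂) ⊤ ⊗ᴾ OS L G₂ (G₁ ∨ G₂)) ⊗ᴾ OS L G₁ (G₁ ∨ G₂)}
      (OSmap-through G₂ G₁ (G₁ ∨ G₂)) (σ₂₃ ∘H OSmap-through G₁ G₂ (G₁ ∨ G₂))
  OSmap-commute {G₁} {G₂} 𝒢G₁ 𝒢G₂ G₁≰G₂ G₂≰G₁ nested =
    pointwise⇒HomEq {f = OSmap-through G₂ G₁ J} {g = σ₂₃ ∘H OSmap-through G₁ G₂ J} onAtom
    where
    J : Carrier
    J = G₁ ∨ G₂
    onAtom : ∀ v → app (OSmap-through G₂ G₁ J) v ≡ app (σ₂₃ ∘H OSmap-through G₁ G₂ J) v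
    onAtom (H , p) with toSum (H ≤? G₁) | toSum (H ≤? G₂)
    ... | inj₁ H≤G₁ | inj₁ H≤G₂ = trans (OSmap-through-below-both p H≤G₂ H≤G₁)
                                        (sym (cong (_⟪ _ ⟫) (OSmap-through-below-both p H≤G₁ H≤G₂)))
    ... | inj₂ H≰G₁ | inj₁ H≤G₂ = trans (OSmap-through-below p q H≤G₂)
                                        (sym (cong (_⟪ _ ⟫) (OSmap-through-middle p q H≰G₁)))
      where
      q : T (atomᵇ G₁ J (G₁ ∨ H))
      q = atomᵇ-∨ p H≰G₁ (∨-least (x≤x∨y G₁ G₂) (≤-trans H≤G₂ (y≤x∨y G₁ G₂)))
    ... | inj₁ H≤G₁ | inj₂ H≰G₂ = trans (OSmap-through-middle p q H≰G₂)
                                        (sym (cong (_⟪ _ ⟫) (OSmap-through-below p q H≤G₁)))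
      where
      q : T (atomᵇ G₂ J (G₂ ∨ H))
      q = atomᵇ-∨ p H≰G₂ (∨-least (y≤x∨y G₁ G₂) (≤-trans H≤G₁ (x≤x∨y G₁ G₂)))
    ... | inj₂ H≰G₁ | inj₂ H≰G₂ = trans (OSmap-through-above p q (y≤x∨y G₁ G₂) H≰J)
                                        (sym (cong (_⟪ _ ⟫) (OSmap-through-above p q (x≤x∨y G₁ G₂) H≰J)))
      where
      H≰J : ¬ H ≤ J
      H≰J = [ H≰G₁ , H≰G₂ ]′ ∘ atom-below-nested-join 𝒢G₁ 𝒢G₂ G₁≰G₂ G₂≰G₁ nested
                                  (proj₁ (Equivalence.to T-atomᵇ p))
      q : T (atomᵇ J ⊤ (J ∨ H))
      q = atomᵇ-∨ p H≰J (maximum _)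

mainTheorem13 :
  (L : GeometricLattice) (𝒢 : GeometricLattice.Carrier L → Bool)
  → IsBuildingSet L 𝒢
  → 𝒢 (GeometricLattice.⊤ L) ≡ true
  → let open GeometricLattice L
        0̂ = ⊥
        1̂ = ⊤
    in
    (∀ G₁ G₂ → 𝒢 G₁ ≡ true → 𝒢 G₂ ≡ true → G₁ < G₂ → G₂ < 1̂
      → HomEq {OS L 0̂ 1̂} {OS L G₂ 1̂ ⊗ᴾ (OS L G₁ G₂ ⊗ᴾ OS L 0̂ G₁)}
          ((idH ⊗H OSmap L 0̂ G₁ G₂) ∘H OSmap L 0̂ G₂ 1̂)
          (assocH ∘H (OSmap L G₁ G₂ 1̂ ⊗H idH) ∘H OSmap L 0̂ G₁ 1̂))
    ×
    (∀ G₁ G₂ → 𝒢 G₁ ≡ true → 𝒢 G₂ ≡ true → G₁ ≢ 1̂ → G₂ ≢ 1̂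
      → ¬ (G₁ ≤ G₂) → ¬ (G₂ ≤ G₁)
      → IsNested L 𝒢 (G₁ ∷ G₂ ∷ [])
      → HomEq {OS L 0̂ 1̂}
          {(OS L (G₁ ∨ G₂) 1̂ ⊗ᴾ OS L G₂ (G₁ ∨ G₂)) ⊗ᴾ OS L G₁ (G₁ ∨ G₂)}
          ((idH ⊗H joinMap L 0̂ G₂ G₁ (G₁ ∨ G₂))
           ∘H (OSmap L G₂ (G₁ ∨ G₂) 1̂ ⊗H idH) ∘H OSmap L 0̂ G₂ 1̂)
          (σ₂₃ ∘H (idH ⊗H joinMap L 0̂ G₁ G₂ (G₁ ∨ G₂))
           ∘H (OSmap L G₁ (G₁ ∨ G₂) 1̂ ⊗H idH) ∘H OSmap L 0̂ G₁ 1̂))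
    ×
    (∀ (L' : GeometricLattice) (𝒢' : GeometricLattice.Carrier L' → Bool)
       (f : Carrier → GeometricLattice.Carrier L')
      → IsPosetIso L L' f
      → (∀ X → 𝒢' (f X) ≡ 𝒢 X)
      → ∀ G → 𝒢 G ≡ true → G ≢ 1̂
      → HomEq {OS L 0̂ 1̂}
          {OS L' (f G) (GeometricLattice.⊤ L') ⊗ᴾ OS L' (GeometricLattice.⊥ L') (f G)}
          (OSmap L' (GeometricLattice.⊥ L') (f G) (GeometricLattice.⊤ L')
           ∘H ψ L L' f 0̂ 1̂ (GeometricLattice.⊥ L') (GeometricLattice.⊤ L'))
          ((ψ L L' f G 1̂ (f G) (GeometricLattice.⊤ L')
            ⊗H ψ L L' f 0̂ G (GeometricLattice.⊥ L') (f G))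
           ∘H OSmap L 0̂ G 1̂))
mainTheorem13 L 𝒢 building _ =
    (λ _ _ _ _ G₁<G₂ _ → OSmap-coassoc (proj₁ G₁<G₂))
  , (λ _ _ 𝒢G₁ 𝒢G₂ _ _ → OSmap-commute 𝒢G₁ 𝒢G₂)
  , (λ L′ _ f iso _ G _ _ → PosetIsoProperties.OSmap-natural L L′ f iso G)
  where
  open GeometricLatticeProperties L
  open BuildingSetProperties L 𝒢 building
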